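{- Let $(U,\varphi)$ be a finite standard closure space whose lattice of closed sets is atomistic and modular. Then the $E$-base of $(U,\varphi)$ is valid and its (aggregated) $E$-base equals its canonical base.
   Context: $(U,\varphi)$: finite set with closure operator; closed sets form a lattice under inclusion; standard: $\varphi(\{x\})\setminus\{x\}$ closed for all $x$. Atomistic: every join-irreducible closed set (one with exactly one predecessor) covers $\emptyset$. Quasi-closed $Q$: for all $X\subseteq Q$ with $\varphi(X)\subsetneq\varphi(Q)$, $\varphi(X)\subseteq Q$; pseudo-closed $P$: not closed and inclusion-minimal among quasi-closed $Q$ with $\varphi(Q)=\varphi(P)$. Canonical base: $\{P\to\varphi(P)\setminus P: P \text{ pseudo-closed}\}$. $\varphi^b(X)=\bigcup_{y\in X}\varphi(\{y\})$. $D$-generator of $x$: $A$ with $x\in\varphi(A)$, $x\notin\varphi^b(A)$, and $x\notin\varphi(B)$ whenever $\varphi^b(B)\subsetneq\varphi^b(A)$; $E$-generator: a $D$-generator $A$ with $\varphi(A)$ inclusion-minimal among closures of $D$-generators of $x$. $E$-base: $\{a\to x: x\neq a,x\in\varphi(\{a\})\}\cup\{A\to x: A \text{ an } E\text{ -generator of } x\}$; aggregated form merges implications with equal premises. Valid: the induced closure operator (closed sets $C$ with $A\subseteq C\Rightarrow X\subseteq C$ for all implications $A\to X$) equals $\varphi$. -}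

module Defs where

open import Data.Nat using (ℕ)
open import Data.Fin using (Fin)
open import Data.Fin.Subset using (Subset; _∈_; _∉_; _⊆_; _⊂_; _∪_; _∩_; _─_; ⁅_⁆; ⊥; ⋃)
open import Data.Fin.Subset.Properties using (_∈?_)
open import Data.List as List using (List)
open import Data.List.Base using (allFin)
open import Data.Product using (Σ; ∃; _×_; _,_)
open import Data.Sum using (_⊎_)
open import Relation.Nullary using (¬_)
open import Relation.Binary.PropositionalEquality using (_≡_; _≢_)
open import Function.Bundles using (_⇔_)

record IsClosureOperator {n : ℕ} (φ : Subset n → Subset n) : Set where
  field
    extensive  : ∀ X → X ⊆ φ X
    monotone   : ∀ X Y → X ⊆ Y → φ X ⊆ φ Y
    idempotent : ∀ X → φ (φ X) ≡ φ X

module ClosureSpace {n : ℕ} (φ : Subset n → Subset n) where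

  Closed : Subset n → Set
  Closed C = φ C ≡ C

  Standard : Set
  Standard = ∀ (x : Fin n) → Closed (φ ⁅ x ⁆ ─ ⁅ x ⁆)

  _⋖_ : Subset n → Subset n → Set
  D ⋖ C = Closed D × Closed C × D ⊂ C
          × (∀ E → Closed E → D ⊂ E → ¬ (E ⊂ C))

  JoinIrreducible : Subset n → Set
  JoinIrreducible C = Closed C × Σ (Subset n) λ D → D ⋖ C × (∀ D′ → D′ ⋖ C → D′ ≡ D)

  Atomistic : Set
  Atomistic = ∀ C → JoinIrreducible C → ⊥ ⋖ C

  _∨c_ : Subset n → Subset n → Subset n
  A ∨c B = φ (A ∪ B)

  Modular : Set
  Modular = ∀ A B C → Closed A → Closed B → Closed C → A ⊆ C →
            A ∨c (B ∩ C) ≡ (A ∨c B) ∩ C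

  QuasiClosed : Subset n → Set
  QuasiClosed Q = ∀ X → X ⊆ Q → φ X ⊂ φ Q → φ X ⊆ Q

  PseudoClosed : Subset n → Set
  PseudoClosed P = ¬ Closed P × QuasiClosed P
                   × (∀ Q → QuasiClosed Q → φ Q ≡ φ P → Q ⊆ P → Q ≡ P)

  -- canonical base: P → φ(P) \ P, as a set of implications (premise, conclusion)
  CanonicalBase : Subset n → Subset n → Set
  CanonicalBase A X = PseudoClosed A × X ≡ φ A ─ A

  φᵇ : Subset n → Subset n
  φᵇ X = ⋃ (List.map (λ y → φ ⁅ y ⁆) (List.filter (λ y → y ∈? X) (allFin n)))

  DGenerator : Subset n → Fin n → Set
  DGenerator A x = x ∈ φ A × x ∉ φᵇ A × (∀ B → φᵇ B ⊂ φᵇ A → x ∉ φ B)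

  EGenerator : Subset n → Fin n → Set
  EGenerator A x = DGenerator A x × (∀ B → DGenerator B x → ¬ (φ B ⊂ φ A))

  -- E-base, implications with singleton conclusions A → x
  EBase : Subset n → Fin n → Set
  EBase A x = (Σ (Fin n) λ a → A ≡ ⁅ a ⁆ × x ≢ a × x ∈ φ ⁅ a ⁆) ⊎ EGenerator A x

  -- aggregated E-base: for each premise A occurring in the E-base,
  -- the single implication A → {x : A → x in the E-base}
  AggregatedEBase : Subset n → Subset n → Set
  AggregatedEBase A X = (∃ λ x → EBase A x) × (∀ y → (y ∈ X) ⇔ EBase A y)

  -- C is closed for the closure operator induced by the E-base
  EBaseClosed : Subset n → Set
  EBaseClosed C = ∀ A x → EBase A x → A ⊆ C → x ∈ C

  -- validity: the closed sets of the induced closure operator are those of φ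
  EBaseValid : Set
  EBaseValid = ∀ C → EBaseClosed C ⇔ Closed C

  AggregatedEBase≡CanonicalBase : Set
  AggregatedEBase≡CanonicalBase = ∀ A X → AggregatedEBase A X ⇔ CanonicalBase A X

{-# OPTIONS --safe #-}
-- Standardness makes φ⁅x⁆ join-irreducible with predecessor φ⁅x⁆ ─ ⁅x⁆; atomisticity forces that
-- predecessor to be ∅, so ∅ and all points are closed, φᵇ is the identity, and a D-generator of x
-- is just a set A with x ∈ φ A ─ A that is minimal for inclusion. The modular law with a point
-- yields the exchange property (y ∈ φ{a,b}, y ≢ a ⇒ b ∈ φ{a,y}), so a point of φ({p} ∪ F), F
-- closed, lies on a line through p and a point of F, and a set containing the line through any
-- two of its points is closed. Hence the E-generators of x are exactly the pairs {a,b} with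
-- x ∈ φ{a,b} ─ {a,b}: for an E-generator A ∋ a, x lies on a line through a and a point of
-- φ(A - a), E-minimality makes φ A that line, and D-minimality shrinks A to a pair; conversely two
-- distinct points span their line. A pseudo-closed set contains a pair whose line leaves it, and
-- quasi-closedness plus minimality make the set equal to that pair. So the canonical base and the
-- aggregated E-base both consist of the implications {a,b} → φ{a,b} ─ {a,b} for the non-closed
-- pairs, and these determine closedness.
module Submission where

open import Defs
open import Data.Nat using (ℕ)
open import Data.Fin using (Fin; _≟_)
open import Data.Fin.Properties using (any?)
open import Data.Fin.Subset
  using (Subset; _∈_; _∉_; _⊆_; _⊂_; _∪_; _∩_; _─_; _-_; ⁅_⁆; ⊥; ⋃; Nonempty; Empty; inside)
open import Data.Fin.Subset.Properties
open import Data.List as List using ([]; _∷_; allFin)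
open import Data.List.Relation.Unary.All using (All; []; _∷_)
open import Data.List.Relation.Unary.All.Properties using (all-filter)
open import Data.List.Relation.Unary.Any using (Any; here; there)
open import Data.List.Relation.Unary.Any.Properties using (map⁺; map⁻)
open import Data.List.Membership.Propositional using (find; lose)
open import Data.List.Membership.Propositional.Properties using (∈-filter⁺; ∈-filter⁻; ∈-allFin)
open import Data.Product using (_×_; ∃; ∃₂; _,_; proj₁; proj₂; uncurry)
open import Data.Sum using (_⊎_; inj₁; inj₂; [_,_]′)
import Data.Vec as Vec
open import Function using (_∘_; id)
open import Function.Bundles using (_⇔_; mk⇔; Equivalence)
open import Relation.Nullary using (¬_; yes; no; contradiction)
open import Relation.Nullary.Decidable using (_×-dec_; ¬?)
open import Relation.Binary.PropositionalEquality
  using (_≡_; _≢_; refl; sym; trans; cong; subst; subst₂; module ≡-Reasoning)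

open Equivalence using (to; from)

x∈p─q⇒x∉q : ∀ {n} {x : Fin n} (p q : Subset n) → x ∈ p ─ q → x ∉ q
x∈p─q⇒x∉q (_ Vec.∷ p) (inside Vec.∷ q) () Vec.here
x∈p─q⇒x∉q (_ Vec.∷ p) (_ Vec.∷ q) (Vec.there x∈p─q) (Vec.there x∈q) = x∈p─q⇒x∉q p q x∈p─q x∈q

module _ {n : ℕ} where

  x∈p─q⁻ : ∀ {x : Fin n} (p q : Subset n) → x ∈ p ─ q → x ∈ p × x ∉ q
  x∈p─q⁻ p q x∈p─q = p─q⊆p p q x∈p─q , x∈p─q⇒x∉q p q x∈p─q

  ∪-lub : ∀ {p q r : Subset n} → p ⊆ r → q ⊆ r → p ∪ q ⊆ r
  ∪-lub {p} {q} p⊆r q⊆r x∈p∪q = [ p⊆r , q⊆r ]′ (x∈p∪q⁻ p q x∈p∪q)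

  ∪-monoʳ : ∀ {p q r : Subset n} → q ⊆ r → p ∪ q ⊆ p ∪ r
  ∪-monoʳ {p} {r = r} q⊆r = ∪-lub (p⊆p∪q r) (q⊆p∪q p r ∘ q⊆r)

  x∈p⇒⁅x⁆⊆p : ∀ {x : Fin n} {p} → x ∈ p → ⁅ x ⁆ ⊆ p
  x∈p⇒⁅x⁆⊆p {x} {p} x∈p y∈⁅x⁆ = subst (_∈ p) (sym (x∈⁅y⁆⇒x≡y x y∈⁅x⁆)) x∈p

  p⊆⁅x⁆∪p-x : ∀ (p : Subset n) x → p ⊆ ⁅ x ⁆ ∪ (p - x)
  p⊆⁅x⁆∪p-x p x {y} y∈p with y ≟ x
  ... | yes refl = x∈p∪q⁺ (inj₁ (x∈⁅x⁆ x))
  ... | no y≢x   = x∈p∪q⁺ (inj₂ (x∈p∧x≢y⇒x∈p-y y∈p y≢x))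

  p⊂q⇒q⊈p : ∀ {p q : Subset n} → p ⊂ q → ¬ q ⊆ p
  p⊂q⇒q⊈p (_ , x , x∈q , x∉p) q⊆p = x∉p (q⊆p x∈q)

  ⊆∧⊄⇒≡ : ∀ {p q : Subset n} → p ⊆ q → ¬ p ⊂ q → p ≡ q
  ⊆∧⊄⇒≡ {p} {q} p⊆q p⊄q = ⊆-antisym p⊆q q⊆p
    where
    q⊆p : q ⊆ p
    q⊆p {x} x∈q with x ∈? p
    ... | yes x∈p = x∈p
    ... | no  x∉p = contradiction ((λ {y} → p⊆q {y}) , x , x∈q , x∉p) p⊄q

  x∈⋃⁺ : ∀ {x : Fin n} {ps} → Any (x ∈_) ps → x ∈ ⋃ ps
  x∈⋃⁺ (here x∈p)   = x∈p∪q⁺ (inj₁ x∈p)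
  x∈⋃⁺ (there x∈ps) = x∈p∪q⁺ (inj₂ (x∈⋃⁺ x∈ps))

  x∈⋃⁻ : ∀ {x : Fin n} ps → x ∈ ⋃ ps → Any (x ∈_) ps
  x∈⋃⁻ []       x∈⊥     = contradiction x∈⊥ ∉⊥
  x∈⋃⁻ (p ∷ ps) x∈p∪ps = [ here , there ∘ x∈⋃⁻ ps ]′ (x∈p∪q⁻ p (⋃ ps) x∈p∪ps)

  pair : Fin n → Fin n → Subset n
  pair a b = ⁅ a ⁆ ∪ ⁅ b ⁆

  IsPair : Subset n → Set
  IsPair A = ∃₂ λ a b → A ≡ pair a b

  pair-comm : ∀ a b → pair a b ≡ pair b a
  pair-comm a b = ∪-comm ⁅ a ⁆ ⁅ b ⁆

  a∈pair : ∀ {a b} → a ∈ pair a b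
  a∈pair {a} = x∈p∪q⁺ (inj₁ (x∈⁅x⁆ a))

  b∈pair : ∀ {a b} → b ∈ pair a b
  b∈pair {b = b} = x∈p∪q⁺ (inj₂ (x∈⁅x⁆ b))

  x∈pair⁻ : ∀ {a b x} → x ∈ pair a b → x ≡ a ⊎ x ≡ b
  x∈pair⁻ {a} {b} x∈ab = [ inj₁ ∘ x∈⁅y⁆⇒x≡y a , inj₂ ∘ x∈⁅y⁆⇒x≡y b ]′ (x∈p∪q⁻ ⁅ a ⁆ ⁅ b ⁆ x∈ab)

  x∉pair : ∀ {a b x} → x ≢ a → x ≢ b → x ∉ pair a b
  x∉pair x≢a x≢b x∈ab = [ x≢a , x≢b ]′ (x∈pair⁻ x∈ab)

  pair-⊆ : ∀ {a b p} → a ∈ p → b ∈ p → pair a b ⊆ p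
  pair-⊆ a∈p b∈p = ∪-lub (x∈p⇒⁅x⁆⊆p a∈p) (x∈p⇒⁅x⁆⊆p b∈p)

  ⊆pair∧∉⇒⊆⁅⁆ : ∀ {X a b} → X ⊆ pair a b → b ∉ X → X ⊆ ⁅ a ⁆
  ⊆pair∧∉⇒⊆⁅⁆ X⊆ab b∉X {y} y∈X with x∈pair⁻ (X⊆ab y∈X)
  ... | inj₁ refl = x∈⁅x⁆ y
  ... | inj₂ refl = contradiction y∈X b∉X

  ⊆pair⇒≡⊎⊆⁅⁆ : ∀ {X a b} → X ⊆ pair a b → X ≡ pair a b ⊎ X ⊆ ⁅ a ⁆ ⊎ X ⊆ ⁅ b ⁆
  ⊆pair⇒≡⊎⊆⁅⁆ {X} {a} {b} X⊆ab with a ∈? X | b ∈? X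
  ... | yes a∈X | yes b∈X = inj₁ (⊆-antisym X⊆ab (pair-⊆ a∈X b∈X))
  ... | _       | no  b∉X = inj₂ (inj₁ (⊆pair∧∉⇒⊆⁅⁆ X⊆ab b∉X))
  ... | no  a∉X | yes _   =
    inj₂ (inj₂ (⊆pair∧∉⇒⊆⁅⁆ (⊆-trans X⊆ab (⊆-reflexive (pair-comm a b))) a∉X))

module ClosureOperatorProperties {n : ℕ} {φ : Subset n → Subset n} (cl : IsClosureOperator φ) where

  open ClosureSpace φ
  open IsClosureOperator cl

  φ-ext : ∀ {X} → X ⊆ φ X
  φ-ext = extensive _

  φ-mono : ∀ {X Y} → X ⊆ Y → φ X ⊆ φ Y
  φ-mono = monotone _ _

  φ-closed : ∀ X → Closed (φ X)
  φ-closed = idempotent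

  φ-least : ∀ {X C} → Closed C → X ⊆ C → φ X ⊆ C
  φ-least C-closed X⊆C = ⊆-trans (φ-mono X⊆C) (⊆-reflexive C-closed)

  φ-⊆ : ∀ {X Y} → X ⊆ φ Y → φ X ⊆ φ Y
  φ-⊆ = φ-least (φ-closed _)

  ¬closed⇒nonempty : ∀ {X} → ¬ Closed X → Nonempty (φ X ─ X)
  ¬closed⇒nonempty {X} ¬closed with nonempty? (φ X ─ X)
  ... | yes nonempty = nonempty
  ... | no  empty    = contradiction (⊆-antisym φX⊆X φ-ext) ¬closed
    where
    φX⊆X : φ X ⊆ X
    φX⊆X {x} x∈φX with x ∈? X
    ... | yes x∈X = x∈X
    ... | no  x∉X = contradiction (x , x∈p∧x∉q⇒x∈p─q x∈φX x∉X) empty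

  ∈φ∧∉⇒¬closed : ∀ {X x} → x ∈ φ X → x ∉ X → ¬ Closed X
  ∈φ∧∉⇒¬closed {x = x} x∈φX x∉X X-closed = x∉X (subst (x ∈_) X-closed x∈φX)

  ∈φᵇ⁺ : ∀ {X y z} → z ∈ X → y ∈ φ ⁅ z ⁆ → y ∈ φᵇ X
  ∈φᵇ⁺ {X} z∈X y∈φz = x∈⋃⁺ (map⁺ (lose (∈-filter⁺ (_∈? X) (∈-allFin _) z∈X) y∈φz))

  ∈φᵇ⁻ : ∀ {X y} → y ∈ φᵇ X → ∃ λ z → z ∈ X × y ∈ φ ⁅ z ⁆
  ∈φᵇ⁻ {X} y∈φᵇX
    with find (map⁻ (x∈⋃⁻ (List.map (λ z → φ ⁅ z ⁆) (List.filter (_∈? X) (allFin n))) y∈φᵇX))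
  ... | z , z∈X′ , y∈φz = z , proj₂ (∈-filter⁻ (_∈? X) {xs = allFin n} z∈X′) , y∈φz

  below-point : ∀ {E x} → Closed E → E ⊂ φ ⁅ x ⁆ → E ⊆ φ ⁅ x ⁆ ─ ⁅ x ⁆
  below-point {E} {x} E-closed (E⊆φx , y , y∈φx , y∉E) {z} z∈E =
    x∈p∧x∉q⇒x∈p─q (E⊆φx z∈E) z∉⁅x⁆
    where
    z∉⁅x⁆ : z ∉ ⁅ x ⁆
    z∉⁅x⁆ z∈⁅x⁆ = y∉E (φ-least E-closed (x∈p⇒⁅x⁆⊆p (subst (_∈ E) (x∈⁅y⁆⇒x≡y x z∈⁅x⁆) z∈E)) y∈φx)

  eBase-sound : ∀ {A x} → EBase A x → x ∈ φ A
  eBase-sound (inj₁ (_ , refl , _ , x∈φa)) = x∈φa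
  eBase-sound (inj₂ ((x∈φA , _) , _))     = x∈φA

  closed⇒eBaseClosed : ∀ {C} → Closed C → EBaseClosed C
  closed⇒eBaseClosed C-closed A x x∈EBase A⊆C = φ-least C-closed A⊆C (eBase-sound x∈EBase)

module StandardClosureSpace {n : ℕ} {φ : Subset n → Subset n} (cl : IsClosureOperator φ)
  (standard : ClosureSpace.Standard φ) where

  open ClosureSpace φ
  open ClosureOperatorProperties cl

  ∅-closed : Closed ⊥
  ∅-closed = ⊆-antisym φ⊥⊆⊥ ⊥⊆
    where
    φ⊥⊆⊥ : φ ⊥ ⊆ ⊥
    φ⊥⊆⊥ {y} y∈φ⊥ = contradiction (x∈⁅x⁆ y) (x∈p─q⇒x∉q _ _ (φ-least (standard y) ⊥⊆ y∈φ⊥))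

  φ⁅x⁆─⁅x⁆⊂φ⁅x⁆ : ∀ x → φ ⁅ x ⁆ ─ ⁅ x ⁆ ⊂ φ ⁅ x ⁆
  φ⁅x⁆─⁅x⁆⊂φ⁅x⁆ x = p─q⊆p _ _ , x , φ-ext (x∈⁅x⁆ x) , λ x∈ → x∈p─q⇒x∉q _ _ x∈ (x∈⁅x⁆ x)

  φ⁅x⁆─⁅x⁆⋖φ⁅x⁆ : ∀ x → (φ ⁅ x ⁆ ─ ⁅ x ⁆) ⋖ φ ⁅ x ⁆
  φ⁅x⁆─⁅x⁆⋖φ⁅x⁆ x = standard x , φ-closed _ , φ⁅x⁆─⁅x⁆⊂φ⁅x⁆ x ,
    λ { E E-closed (_ , y , y∈E , y∉pred) E⊂φx → y∉pred (below-point E-closed E⊂φx y∈E) }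

  φ⁅x⁆-joinIrreducible : ∀ x → JoinIrreducible (φ ⁅ x ⁆)
  φ⁅x⁆-joinIrreducible x = φ-closed _ , _ , φ⁅x⁆─⁅x⁆⋖φ⁅x⁆ x , unique
    where
    unique : ∀ D → D ⋖ φ ⁅ x ⁆ → D ≡ φ ⁅ x ⁆ ─ ⁅ x ⁆
    unique D (D-closed , _ , D⊂φx , D-covered) =
      ⊆∧⊄⇒≡ (below-point D-closed D⊂φx)
            (λ D⊂pred → D-covered _ (standard x) D⊂pred (φ⁅x⁆─⁅x⁆⊂φ⁅x⁆ x))

  point-closed : Atomistic → ∀ x → Closed ⁅ x ⁆
  point-closed atomistic x = ⊆-antisym φx⊆x φ-ext
    where
    ∅-covered : ∀ E → Closed E → ⊥ ⊂ E → ¬ (E ⊂ φ ⁅ x ⁆)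
    ∅-covered = proj₂ (proj₂ (proj₂ (atomistic _ (φ⁅x⁆-joinIrreducible x))))
    φx⊆x : φ ⁅ x ⁆ ⊆ ⁅ x ⁆
    φx⊆x {y} y∈φx with y ≟ x
    ... | yes refl = x∈⁅x⁆ x
    ... | no  y≢x  = contradiction (φ⁅x⁆─⁅x⁆⊂φ⁅x⁆ x) (∅-covered _ (standard x) ∅⊂pred)
      where
      ∅⊂pred : ⊥ ⊂ φ ⁅ x ⁆ ─ ⁅ x ⁆
      ∅⊂pred = ⊥⊆ , y , x∈p∧x∉q⇒x∈p─q y∈φx (x≢y⇒x∉⁅y⁆ y≢x) , ∉⊥

module PointClosedSpace {n : ℕ} {φ : Subset n → Subset n} (cl : IsClosureOperator φ)
  (∅-closed : ClosureSpace.Closed φ ⊥) (point-closed : ∀ x → ClosureSpace.Closed φ ⁅ x ⁆) where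

  open ClosureSpace φ
  open ClosureOperatorProperties cl

  ∈φ⁅⁆⇒≡ : ∀ {x y} → y ∈ φ ⁅ x ⁆ → y ≡ x
  ∈φ⁅⁆⇒≡ {x} {y} y∈φx = x∈⁅y⁆⇒x≡y x (subst (y ∈_) (point-closed x) y∈φx)

  φᵇ≡id : ∀ X → φᵇ X ≡ X
  φᵇ≡id X = ⊆-antisym φᵇX⊆X (λ {y} y∈X → ∈φᵇ⁺ y∈X (φ-ext (x∈⁅x⁆ y)))
    where
    φᵇX⊆X : φᵇ X ⊆ X
    φᵇX⊆X y∈φᵇX with ∈φᵇ⁻ y∈φᵇX
    ... | z , z∈X , y∈φz = subst (_∈ X) (sym (∈φ⁅⁆⇒≡ y∈φz)) z∈X

  empty-closed : ∀ {X} → Empty X → Closed X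
  empty-closed X-empty = subst Closed (sym (Empty-unique X-empty)) ∅-closed

  ⊆⁅⁆⇒closed : ∀ {X x} → X ⊆ ⁅ x ⁆ → Closed X
  ⊆⁅⁆⇒closed {X} {x} X⊆x with x ∈? X
  ... | yes x∈X = subst Closed (⊆-antisym (x∈p⇒⁅x⁆⊆p x∈X) X⊆x) (point-closed x)
  ... | no  x∉X = empty-closed λ { (y , y∈X) → x∉X (subst (_∈ X) (x∈⁅y⁆⇒x≡y x (X⊆x y∈X)) y∈X) }

  ¬closed⇒twoPoints : ∀ {A} → ¬ Closed A → ∃₂ λ a c → a ∈ A × c ∈ A × c ≢ a
  ¬closed⇒twoPoints {A} ¬closed with nonempty? A
  ... | no  A-empty  = contradiction (empty-closed A-empty) ¬closed
  ... | yes (a , a∈A) with nonempty? (A - a)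
  ...   | yes (c , c∈A-a) = a , c , a∈A , p─q⊆p A ⁅ a ⁆ c∈A-a , x∉⁅y⁆⇒x≢y (x∈p─q⇒x∉q A ⁅ a ⁆ c∈A-a)
  ...   | no  A-a-empty   = contradiction (⊆⁅⁆⇒closed A⊆a) ¬closed
    where
    A⊆a : A ⊆ ⁅ a ⁆
    A⊆a {y} y∈A with y ≟ a
    ... | yes refl = x∈⁅x⁆ a
    ... | no  y≢a  = contradiction (y , x∈p∧x≢y⇒x∈p-y y∈A y≢a) A-a-empty

  ⊆pair⇒≡⊎closed : ∀ {X a b} → X ⊆ pair a b → X ≡ pair a b ⊎ Closed X
  ⊆pair⇒≡⊎closed X⊆ab = [ inj₁ , inj₂ ∘ [ ⊆⁅⁆⇒closed , ⊆⁅⁆⇒closed ]′ ]′ (⊆pair⇒≡⊎⊆⁅⁆ X⊆ab)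

  ⊂pair⇒closed : ∀ {X a b} → X ⊂ pair a b → Closed X
  ⊂pair⇒closed X⊂ab =
    [ (λ X≡ab → contradiction X⊂ab (⊂-irref X≡ab)) , id ]′ (⊆pair⇒≡⊎closed (proj₁ X⊂ab))

  pair-quasiClosed : ∀ {a b} → QuasiClosed (pair a b)
  pair-quasiClosed X X⊆ab φX⊂φab with ⊆pair⇒≡⊎closed X⊆ab
  ... | inj₁ refl     = contradiction φX⊂φab (⊂-irref refl)
  ... | inj₂ X-closed = ⊆-trans (⊆-reflexive X-closed) X⊆ab

  pair⇒pseudoClosed : ∀ {a b} → ¬ Closed (pair a b) → PseudoClosed (pair a b)
  pair⇒pseudoClosed {a} {b} ¬closed = ¬closed , pair-quasiClosed , minimal
    where
    minimal : ∀ Q → QuasiClosed Q → φ Q ≡ φ (pair a b) → Q ⊆ pair a b → Q ≡ pair a b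
    minimal Q _ φQ≡φab Q⊆ab with ⊆pair⇒≡⊎closed Q⊆ab
    ... | inj₁ Q≡ab     = Q≡ab
    ... | inj₂ Q-closed = contradiction (⊆-antisym φab⊆ab φ-ext) ¬closed
      where
      φab⊆ab : φ (pair a b) ⊆ pair a b
      φab⊆ab = ⊆-trans (⊆-reflexive (trans (sym φQ≡φab) Q-closed)) Q⊆ab

  MinimalGenerator : Subset n → Fin n → Set
  MinimalGenerator A x = x ∈ φ A × x ∉ A × (∀ B → B ⊂ A → x ∉ φ B)

  dGenerator⇔ : ∀ {A x} → DGenerator A x ⇔ MinimalGenerator A x
  dGenerator⇔ {A} {x} = mk⇔
    (λ (x∈φA , x∉φᵇA , minimal) → x∈φA , x∉φᵇA ∘ subst (x ∈_) (sym (φᵇ≡id A)) ,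
                                    λ B → minimal B ∘ subst₂ _⊂_ (sym (φᵇ≡id B)) (sym (φᵇ≡id A)))
    (λ (x∈φA , x∉A , minimal) → x∈φA , x∉A ∘ subst (x ∈_) (φᵇ≡id A) ,
                                  λ B → minimal B ∘ subst₂ _⊂_ (φᵇ≡id B) (φᵇ≡id A))

  pair⇒dGenerator : ∀ {a b x} → x ∈ φ (pair a b) ─ pair a b → DGenerator (pair a b) x
  pair⇒dGenerator {a} {b} {x} x∈ = from dGenerator⇔ (x∈φab , x∉ab , minimal)
    where
    x∈φab : x ∈ φ (pair a b)
    x∈φab = proj₁ (x∈p─q⁻ (φ (pair a b)) (pair a b) x∈)
    x∉ab : x ∉ pair a b
    x∉ab = proj₂ (x∈p─q⁻ (φ (pair a b)) (pair a b) x∈)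
    minimal : ∀ B → B ⊂ pair a b → x ∉ φ B
    minimal B B⊂ab x∈φB = x∉ab (proj₁ B⊂ab (subst (x ∈_) (⊂pair⇒closed B⊂ab) x∈φB))

  LineClosed : Subset n → Set
  LineClosed P = ∀ {a b} → a ∈ P → b ∈ P → φ (pair a b) ⊆ P

  module _ (modular : Modular) where

    modular-point : ∀ {F C p} → Closed F → Closed C → p ∈ C → Empty (F ∩ C) →
                    φ (⁅ p ⁆ ∪ F) ∩ C ≡ ⁅ p ⁆
    modular-point {F} {C} {p} F-closed C-closed p∈C F∩C-empty = begin
      φ (⁅ p ⁆ ∪ F) ∩ C    ≡⟨ modular ⁅ p ⁆ F C (point-closed p) F-closed C-closed (x∈p⇒⁅x⁆⊆p p∈C) ⟨
      φ (⁅ p ⁆ ∪ (F ∩ C))  ≡⟨ cong (λ S → φ (⁅ p ⁆ ∪ S)) (Empty-unique F∩C-empty) ⟩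
      φ (⁅ p ⁆ ∪ ⊥)        ≡⟨ cong φ (∪-identityʳ ⁅ p ⁆) ⟩
      φ ⁅ p ⁆              ≡⟨ point-closed p ⟩
      ⁅ p ⁆                ∎
      where open ≡-Reasoning

    exchange : ∀ {a b y} → y ∈ φ (pair a b) → y ≢ a → b ∈ φ (pair a y)
    exchange {a} {b} {y} y∈φab y≢a with b ∈? φ (pair a y)
    ... | yes b∈φay = b∈φay
    ... | no  b∉φay = contradiction (x∈⁅y⁆⇒x≡y a y∈⁅a⁆) y≢a
      where
      disjoint : Empty (⁅ b ⁆ ∩ φ (pair a y))
      disjoint (z , z∈) with x∈p∩q⁻ ⁅ b ⁆ (φ (pair a y)) z∈
      ... | z∈⁅b⁆ , z∈φay = b∉φay (subst (_∈ φ (pair a y)) (x∈⁅y⁆⇒x≡y b z∈⁅b⁆) z∈φay)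
      y∈⁅a⁆ : y ∈ ⁅ a ⁆
      y∈⁅a⁆ = subst (y ∈_) (modular-point (point-closed b) (φ-closed _) (φ-ext a∈pair) disjoint)
                           (x∈p∩q⁺ (y∈φab , φ-ext b∈pair))

    exchange-span : ∀ {a b y} → y ∈ φ (pair a b) → y ≢ a → φ (pair a b) ⊆ φ (pair a y)
    exchange-span y∈φab y≢a = φ-⊆ (pair-⊆ (φ-ext a∈pair) (exchange y∈φab y≢a))

    line-spanned : ∀ {a b x y} → x ∈ φ (pair a b) → y ∈ φ (pair a b) → x ≢ y →
                   φ (pair a b) ⊆ φ (pair x y)
    line-spanned {a} {b} {x} {y} x∈φab y∈φab x≢y with x ≟ a
    ... | yes refl = exchange-span y∈φab (x≢y ∘ sym)
    ... | no  x≢a  = ⊆-trans φab⊆φxa (exchange-span (φab⊆φxa y∈φab) (x≢y ∘ sym))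
      where
      φab⊆φxa : φ (pair a b) ⊆ φ (pair x a)
      φab⊆φxa = ⊆-trans (exchange-span x∈φab x≢a) (⊆-reflexive (cong φ (pair-comm a x)))

    ∈φ⁅p⁆∪F⇒∈line : ∀ {F p x} → Closed F → x ∈ φ (⁅ p ⁆ ∪ F) → x ∉ F → x ≢ p →
                    ∃ λ f → f ∈ F × x ∈ φ (pair p f)
    ∈φ⁅p⁆∪F⇒∈line {F} {p} {x} F-closed x∈φpF x∉F x≢p with nonempty? (F ∩ φ (pair p x))
    ... | yes (f , f∈) = f , f∈F , exchange f∈φpx f≢p
      where
      f∈F : f ∈ F
      f∈F = proj₁ (x∈p∩q⁻ F (φ (pair p x)) f∈)
      f∈φpx : f ∈ φ (pair p x)
      f∈φpx = proj₂ (x∈p∩q⁻ F (φ (pair p x)) f∈)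
      f≢p : f ≢ p
      f≢p refl = x∉F (φ-least F-closed (∪-lub (x∈p⇒⁅x⁆⊆p f∈F) ⊆-refl) x∈φpF)
    ... | no  disjoint = contradiction (x∈⁅y⁆⇒x≡y p x∈⁅p⁆) x≢p
      where
      x∈⁅p⁆ : x ∈ ⁅ p ⁆
      x∈⁅p⁆ = subst (x ∈_) (modular-point F-closed (φ-closed _) (φ-ext a∈pair) disjoint)
                           (x∈p∩q⁺ (x∈φpF , φ-ext b∈pair))

    join-point-⊆ : ∀ {P F p} → LineClosed P → Closed F → F ⊆ P → p ∈ P → φ (⁅ p ⁆ ∪ F) ⊆ P
    join-point-⊆ {P} {F} {p} P-lineClosed F-closed F⊆P p∈P {x} x∈ with x ∈? F | x ≟ p
    ... | yes x∈F | _        = F⊆P x∈F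
    ... | no  _   | yes refl = p∈P
    ... | no  x∉F | no  x≢p  with ∈φ⁅p⁆∪F⇒∈line F-closed x∈ x∉F x≢p
    ...   | f , f∈F , x∈φpf = P-lineClosed p∈P (F⊆P f∈F) x∈φpf

    span-⊆ : ∀ {P} → LineClosed P → ∀ ys → All (_∈ P) ys → φ (⋃ (List.map (λ y → φ ⁅ y ⁆) ys)) ⊆ P
    span-⊆ P-lineClosed []       []              = ⊆-trans (⊆-reflexive ∅-closed) ⊥⊆
    span-⊆ P-lineClosed (y ∷ ys) (y∈P ∷ ys⊆P) rewrite point-closed y =
      ⊆-trans (φ-mono (∪-monoʳ φ-ext))
              (join-point-⊆ P-lineClosed (φ-closed _) (span-⊆ P-lineClosed ys ys⊆P) y∈P)

    lineClosed⇒closed : ∀ {P} → LineClosed P → Closed P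
    lineClosed⇒closed {P} P-lineClosed = ⊆-antisym φP⊆P φ-ext
      where
      φP⊆P : φ P ⊆ P
      φP⊆P = ⊆-trans (φ-mono (⊆-reflexive (sym (φᵇ≡id P))))
                     (span-⊆ P-lineClosed _ (all-filter (_∈? P) (allFin n)))

    closed⊎escapingPair : ∀ P → Closed P ⊎ ∃₂ λ a b → a ∈ P × b ∈ P × ¬ φ (pair a b) ⊆ P
    closed⊎escapingPair P
      with any? (λ a → any? (λ b → (a ∈? P) ×-dec (b ∈? P) ×-dec ¬? (φ (pair a b) ⊆? P)))
    ... | yes escaping  = inj₂ escaping
    ... | no  ¬escaping = inj₁ (lineClosed⇒closed P-lineClosed)
      where
      P-lineClosed : LineClosed P
      P-lineClosed {a} {b} a∈P b∈P with φ (pair a b) ⊆? P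
      ... | yes φab⊆P = φab⊆P
      ... | no  φab⊈P = contradiction (a , b , a∈P , b∈P , φab⊈P) ¬escaping

    ∈φ∧∉φ-⇒∈line : ∀ {A x a} → x ∈ φ A → x ∉ φ (A - a) → x ≢ a →
                   ∃ λ f → f ∈ φ (A - a) × x ∈ φ (pair a f) ─ pair a f
    ∈φ∧∉φ-⇒∈line {A} {x} {a} x∈φA x∉φA-a x≢a
      with ∈φ⁅p⁆∪F⇒∈line (φ-closed (A - a))
                          (φ-mono (⊆-trans (p⊆⁅x⁆∪p-x A a) (∪-monoʳ φ-ext)) x∈φA) x∉φA-a x≢a
    ... | f , f∈φA-a , x∈φaf =
      f , f∈φA-a , x∈p∧x∉q⇒x∈p─q x∈φaf (x∉pair x≢a λ { refl → x∉φA-a f∈φA-a })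

    eGenerator⇒pair : ∀ {A x} → EGenerator A x → IsPair A × x ∈ φ A ─ A
    eGenerator⇒pair {A} {x} (A-gen , E-minimal) with to dGenerator⇔ A-gen
    ... | x∈φA , x∉A , minimal with ¬closed⇒twoPoints (∈φ∧∉⇒¬closed x∈φA x∉A)
    ... | a , c , a∈A , c∈A , c≢a
      with ∈φ∧∉φ-⇒∈line x∈φA (minimal (A - a) (x∈p⇒p-x⊂p a∈A)) (λ { refl → x∉A a∈A })
    ... | f , f∈φA-a , x∈φaf─af = (a , c , A≡ac) , x∈p∧x∉q⇒x∈p─q x∈φA x∉A
      where
      φaf≡φA : φ (pair a f) ≡ φ A
      φaf≡φA = ⊆∧⊄⇒≡ (φ-⊆ (pair-⊆ (φ-ext a∈A) (φ-mono (p─q⊆p A ⁅ a ⁆) f∈φA-a)))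
                     (E-minimal (pair a f) (pair⇒dGenerator x∈φaf─af))
      x∈φac : x ∈ φ (pair a c)
      x∈φac = exchange-span (subst (c ∈_) (sym φaf≡φA) (φ-ext c∈A)) c≢a
                            (proj₁ (x∈p─q⁻ _ _ x∈φaf─af))
      A≡ac : A ≡ pair a c
      A≡ac = sym (⊆∧⊄⇒≡ (pair-⊆ a∈A c∈A) (λ ac⊂A → minimal (pair a c) ac⊂A x∈φac))

    pair⇒eGenerator : ∀ {a b x} → x ∈ φ (pair a b) ─ pair a b → EGenerator (pair a b) x
    pair⇒eGenerator {a} {b} {x} x∈ = pair⇒dGenerator x∈ , E-minimal
      where
      x∈φab : x ∈ φ (pair a b)
      x∈φab = proj₁ (x∈p─q⁻ (φ (pair a b)) (pair a b) x∈)
      E-minimal : ∀ B → DGenerator B x → ¬ (φ B ⊂ φ (pair a b))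
      E-minimal B B-gen φB⊂φab with to dGenerator⇔ B-gen
      ... | x∈φB , x∉B , _ with ¬closed⇒twoPoints (∈φ∧∉⇒¬closed x∈φB x∉B)
      ... | e , _ , e∈B , _ = p⊂q⇒q⊈p φB⊂φab φab⊆φB
        where
        x≢e : x ≢ e
        x≢e refl = x∉B e∈B
        φab⊆φB : φ (pair a b) ⊆ φ B
        φab⊆φB = ⊆-trans (line-spanned x∈φab (proj₁ φB⊂φab (φ-ext e∈B)) x≢e)
                         (φ-⊆ (pair-⊆ x∈φB (φ-ext e∈B)))

    eBase⇔ : ∀ {A x} → EBase A x ⇔ (IsPair A × x ∈ φ A ─ A)
    eBase⇔ = mk⇔ eBase⇒pair pair⇒eBase
      where
      eBase⇒pair : ∀ {A x} → EBase A x → IsPair A × x ∈ φ A ─ A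
      eBase⇒pair (inj₁ (a , refl , x≢a , x∈φa)) = contradiction (∈φ⁅⁆⇒≡ x∈φa) x≢a
      eBase⇒pair (inj₂ A-gen)                  = eGenerator⇒pair A-gen
      pair⇒eBase : ∀ {A x} → IsPair A × x ∈ φ A ─ A → EBase A x
      pair⇒eBase ((a , b , refl) , x∈) = inj₂ (pair⇒eGenerator x∈)

    pseudoClosed⇒pair : ∀ {P} → PseudoClosed P → IsPair P
    pseudoClosed⇒pair {P} (¬closed , quasiClosed , minimal) with closed⊎escapingPair P
    ... | inj₁ closed = contradiction closed ¬closed
    ... | inj₂ (a , b , a∈P , b∈P , φab⊈P) =
      a , b , sym (minimal (pair a b) pair-quasiClosed φab≡φP ab⊆P)
      where
      ab⊆P : pair a b ⊆ P
      ab⊆P = pair-⊆ a∈P b∈P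
      φab≡φP : φ (pair a b) ≡ φ P
      φab≡φP = ⊆∧⊄⇒≡ (φ-mono ab⊆P) (φab⊈P ∘ quasiClosed (pair a b) ab⊆P)

    eBaseClosed⇒lineClosed : ∀ {C} → EBaseClosed C → LineClosed C
    eBaseClosed⇒lineClosed C-eBaseClosed {a} {b} a∈C b∈C {z} z∈φab with z ∈? pair a b
    ... | yes z∈ab = pair-⊆ a∈C b∈C z∈ab
    ... | no  z∉ab = C-eBaseClosed (pair a b) z
                       (from eBase⇔ ((a , b , refl) , x∈p∧x∉q⇒x∈p─q z∈φab z∉ab)) (pair-⊆ a∈C b∈C)

    eBase-valid : EBaseValid
    eBase-valid C = mk⇔ (lineClosed⇒closed ∘ eBaseClosed⇒lineClosed) closed⇒eBaseClosed

    aggregatedEBase⇒canonicalBase : ∀ {A X} → AggregatedEBase A X → CanonicalBase A X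
    aggregatedEBase⇒canonicalBase {A} {X} ((x , x∈EBase) , X⇔EBase) with to eBase⇔ x∈EBase
    ... | (a , b , refl) , x∈φA─A =
      pair⇒pseudoClosed (uncurry ∈φ∧∉⇒¬closed (x∈p─q⁻ (φ A) A x∈φA─A)) , ⊆-antisym X⊆φA─A φA─A⊆X
      where
      X⊆φA─A : X ⊆ φ A ─ A
      X⊆φA─A {y} y∈X = proj₂ (to eBase⇔ (to (X⇔EBase y) y∈X))
      φA─A⊆X : φ A ─ A ⊆ X
      φA─A⊆X {y} y∈ = from (X⇔EBase y) (from eBase⇔ ((a , b , refl) , y∈))

    canonicalBase⇒aggregatedEBase : ∀ {A X} → CanonicalBase A X → AggregatedEBase A X
    canonicalBase⇒aggregatedEBase {A} (A-pseudoClosed , refl)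
      with ¬closed⇒nonempty (proj₁ A-pseudoClosed)
    ... | x , x∈φA─A = (x , pair⇒eBase x∈φA─A) , λ y → mk⇔ pair⇒eBase (proj₂ ∘ to eBase⇔)
      where
      pair⇒eBase : ∀ {y} → y ∈ φ A ─ A → EBase A y
      pair⇒eBase y∈ = from eBase⇔ (pseudoClosed⇒pair A-pseudoClosed , y∈)

    aggregatedEBase≡canonicalBase : AggregatedEBase≡CanonicalBase
    aggregatedEBase≡canonicalBase _ _ =
      mk⇔ aggregatedEBase⇒canonicalBase canonicalBase⇒aggregatedEBase

corollary5 : (n : ℕ) (φ : Subset n → Subset n) → IsClosureOperator φ →
    ClosureSpace.Standard φ → ClosureSpace.Atomistic φ → ClosureSpace.Modular φ →
    ClosureSpace.EBaseValid φ × ClosureSpace.AggregatedEBase≡CanonicalBase φ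
corollary5 n φ cl standard atomistic modular =
  eBase-valid modular , aggregatedEBase≡canonicalBase modular
  where
  open StandardClosureSpace cl standard
  open PointClosedSpace cl ∅-closed (point-closed atomistic)
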